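{- Let $G$ be a connected $n$-vertex graph with $\delta(G)>n/3$ in which every vertex belongs to a triangle. Then for any $u,v\in V(G)$ there is an even trail of length at most $8$ between $u$ and $v$.
   Context: A trail is a sequence $v_0,\dots,v_\ell$ of (not necessarily distinct) vertices with $v_{i-1}v_i\in E(G)$ for all $i\in[\ell]$; its length is $\ell$, it is a $v_0$–$v_\ell$ trail, and it is even if $\ell$ is even. -}

module Defs where

open import Data.Nat using (ℕ; zero; suc; _*_; _<_; _≤_)
open import Data.Nat.Properties using ()
open import Data.Fin using (Fin)
open import Data.Fin.Subset using (Subset; ∣_∣)
open import Data.Vec using (tabulate)
open import Data.Bool using (Bool)
open import Data.Product using (Σ; ∃; ∃-syntax; _×_; _,_)
open import Relation.Nullary using (¬_; Dec)
open import Relation.Nullary.Decidable using (does)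
open import Relation.Binary.PropositionalEquality using (_≡_)

record Graph (n : ℕ) : Set₁ where
  field
    Adj      : Fin n → Fin n → Set
    adj?     : (u v : Fin n) → Dec (Adj u v)
    sym      : ∀ {u v} → Adj u v → Adj v u
    irrefl   : ∀ {u} → ¬ Adj u u

open Graph public

nbhd : ∀ {n} (G : Graph n) → Fin n → Subset n
nbhd G v = tabulate (λ u → does (adj? G v u))

degree : ∀ {n} (G : Graph n) → Fin n → ℕ
degree G v = ∣ nbhd G v ∣

-- A trail v_0, ..., v_ℓ of length ℓ from u to w (vertices not necessarily
-- distinct, consecutive vertices adjacent), as in the paper's definition.
data Trail {n : ℕ} (G : Graph n) : Fin n → Fin n → ℕ → Set where
  [_]  : (v : Fin n) → Trail G v v zero
  _∷_  : ∀ {u v w ℓ} → Adj G u v → Trail G v w ℓ → Trail G u w (suc ℓ)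

Connected : ∀ {n} → Graph n → Set
Connected G = ∀ u v → ∃[ ℓ ] Trail G u v ℓ

MinDegGtThird : ∀ {n} → Graph n → Set
MinDegGtThird {n} G = ∀ v → n < 3 * degree G v

InTriangle : ∀ {n} → Graph n → Fin n → Set
InTriangle G v = ∃[ a ] ∃[ b ] (Adj G v a × Adj G v b × Adj G a b)

EvenTrailAtMost8 : ∀ {n} → Graph n → Fin n → Fin n → Set
EvenTrailAtMost8 G u v = ∃[ k ] (2 * k ≤ 8 × Trail G u v (2 * k))

-- Walk along any u–v trail, starting from u itself, for as long as the current
-- vertex shares a neighbour with u. If we reach v, then u–w–v is an even trail
-- of length 2. Otherwise there is an edge yz with y, but not z, sharing a
-- neighbour with u. Since 3δ > n, two of the neighbourhoods of u, v, z meet; the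
-- pair (u, z) is excluded, the pair (u, v) again gives length 2, and the pair
-- (v, z) gives the trail u →³ u →² y →¹ z →² v, where the first leg runs round
-- the triangle at u to fix the parity: 3 + 2 + 1 + 2 = 8.
module Submission where

open import Defs
open import Data.Nat using (ℕ; suc; _+_; _*_; _<_; _≤_)
open import Data.Nat.Properties using (≤-refl; m≤m+n; +-suc; <⇒≱; *-cancelˡ-<; +-mono-<; module ≤-Reasoning)
open import Data.Nat.Tactic.RingSolver using (solve-∀)
open import Data.Fin using (Fin)
open import Data.Fin.Properties using (any?)
open import Data.Fin.Subset using (Subset; ∣_∣; inside; outside; _∈_; _∩_; _∪_; Nonempty; Empty)
open import Data.Fin.Subset.Properties
  using (drop-∷-Empty; nonempty?; ∣p∣≤n; x∈p∩q⁺; x∈p∩q⁻; x∈p∪q⁻)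
open import Data.Vec using (_∷_; []; here)
open import Data.Vec.Properties using ([]=⇒lookup; lookup∘tabulate)
open import Data.Product using (∃-syntax; ∃₂; _×_; _,_; proj₂)
open import Data.Sum using (_⊎_; inj₁; inj₂; map)
open import Data.Empty using (⊥-elim)
open import Relation.Nullary using (¬_; Dec; yes; no; does)
open import Relation.Nullary.Decidable using (_×-dec_)
open import Relation.Binary.PropositionalEquality using (_≡_; refl; trans; cong; subst; module ≡-Reasoning) renaming (sym to ≡-sym)

∣p∪q∣≡∣p∣+∣q∣ : ∀ {n} (p q : Subset n) → Empty (p ∩ q) → ∣ p ∪ q ∣ ≡ ∣ p ∣ + ∣ q ∣
∣p∪q∣≡∣p∣+∣q∣ []            []            _ = refl
∣p∪q∣≡∣p∣+∣q∣ (inside  ∷ p) (inside  ∷ q) e = ⊥-elim (e (_ , here))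
∣p∪q∣≡∣p∣+∣q∣ (inside  ∷ p) (outside ∷ q) e = cong suc (∣p∪q∣≡∣p∣+∣q∣ p q (drop-∷-Empty e))
∣p∪q∣≡∣p∣+∣q∣ (outside ∷ p) (inside  ∷ q) e =
  trans (cong suc (∣p∪q∣≡∣p∣+∣q∣ p q (drop-∷-Empty e))) (≡-sym (+-suc ∣ p ∣ ∣ q ∣))
∣p∪q∣≡∣p∣+∣q∣ (outside ∷ p) (outside ∷ q) e = ∣p∪q∣≡∣p∣+∣q∣ p q (drop-∷-Empty e)

Empty-∪-∩ : ∀ {n} (p q r : Subset n) → Empty (p ∩ r) → Empty (q ∩ r) → Empty ((p ∪ q) ∩ r)
Empty-∪-∩ p q r p∩r≡∅ q∩r≡∅ (x , x∈[p∪q]∩r) with x∈p∩q⁻ (p ∪ q) r x∈[p∪q]∩r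
... | x∈p∪q , x∈r with x∈p∪q⁻ p q x∈p∪q
...   | inj₁ x∈p = p∩r≡∅ (x , x∈p∩q⁺ (x∈p , x∈r))
...   | inj₂ x∈q = q∩r≡∅ (x , x∈p∩q⁺ (x∈q , x∈r))

∣p∣+∣q∣+∣r∣≤n : ∀ {n} (p q r : Subset n) → Empty (p ∩ q) → Empty (p ∩ r) → Empty (q ∩ r) →
                ∣ p ∣ + ∣ q ∣ + ∣ r ∣ ≤ n
∣p∣+∣q∣+∣r∣≤n p q r p∩q≡∅ p∩r≡∅ q∩r≡∅ =
  subst (_≤ _) ∣[p∪q]∪r∣≡∣p∣+∣q∣+∣r∣ (∣p∣≤n ((p ∪ q) ∪ r))
  where
  open ≡-Reasoning
  ∣[p∪q]∪r∣≡∣p∣+∣q∣+∣r∣ : ∣ (p ∪ q) ∪ r ∣ ≡ ∣ p ∣ + ∣ q ∣ + ∣ r ∣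
  ∣[p∪q]∪r∣≡∣p∣+∣q∣+∣r∣ = begin
    ∣ (p ∪ q) ∪ r ∣     ≡⟨ ∣p∪q∣≡∣p∣+∣q∣ (p ∪ q) r (Empty-∪-∩ p q r p∩r≡∅ q∩r≡∅) ⟩
    ∣ p ∪ q ∣ + ∣ r ∣   ≡⟨ cong (_+ ∣ r ∣) (∣p∪q∣≡∣p∣+∣q∣ p q p∩q≡∅) ⟩
    ∣ p ∣ + ∣ q ∣ + ∣ r ∣ ∎

pairwise-meet : ∀ {n} (p q r : Subset n) → n < ∣ p ∣ + ∣ q ∣ + ∣ r ∣ →
                Nonempty (p ∩ q) ⊎ Nonempty (p ∩ r) ⊎ Nonempty (q ∩ r)
pairwise-meet p q r n<∣p∣+∣q∣+∣r∣
  with nonempty? (p ∩ q) | nonempty? (p ∩ r) | nonempty? (q ∩ r)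
... | yes p∩q≢∅ | _         | _         = inj₁ p∩q≢∅
... | no _      | yes p∩r≢∅ | _         = inj₂ (inj₁ p∩r≢∅)
... | no _      | no _      | yes q∩r≢∅ = inj₂ (inj₂ q∩r≢∅)
... | no p∩q≡∅  | no p∩r≡∅  | no q∩r≡∅  =
  ⊥-elim (<⇒≱ n<∣p∣+∣q∣+∣r∣ (∣p∣+∣q∣+∣r∣≤n p q r p∩q≡∅ p∩r≡∅ q∩r≡∅))

<-sum-of-thirds : ∀ {n} a b c → n < 3 * a → n < 3 * b → n < 3 * c → n < a + b + c
<-sum-of-thirds {n} a b c n<3a n<3b n<3c = *-cancelˡ-< 3 n (a + b + c) (begin-strict
  3 * n                 ≡⟨ triple n ⟩
  n + n + n             <⟨ +-mono-< (+-mono-< n<3a n<3b) n<3c ⟩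
  3 * a + 3 * b + 3 * c ≡⟨ distrib a b c ⟩
  3 * (a + b + c)       ∎)
  where
  open ≤-Reasoning
  triple : ∀ m → 3 * m ≡ m + m + m
  triple = solve-∀
  distrib : ∀ x y z → 3 * x + 3 * y + 3 * z ≡ 3 * (x + y + z)
  distrib = solve-∀

module _ {n : ℕ} {G : Graph n} where

  infixr 5 _++_

  _++_ : ∀ {u v w ℓ m} → Trail G u v ℓ → Trail G v w m → Trail G u w (ℓ + m)
  [ _ ]   ++ t = t
  (e ∷ s) ++ t = e ∷ (s ++ t)

  exit-edge : {P : Fin n → Set} → (∀ x → Dec (P x)) → ∀ {x v ℓ} → Trail G x v ℓ → P x →
              P v ⊎ ∃₂ λ y z → P y × Adj G y z × ¬ P z
  exit-edge P? [ _ ] px = inj₁ px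
  exit-edge P? (_∷_ {v = y} e t) px with P? y
  ... | yes py = exit-edge P? t py
  ... | no ¬py = inj₂ (_ , _ , px , e , ¬py)

module _ {n : ℕ} (G : Graph n) where

  triangle⇒closed-trail : ∀ {v} → InTriangle G v → Trail G v v 3
  triangle⇒closed-trail (_ , _ , va , vb , ab) = va ∷ ab ∷ sym G vb ∷ [ _ ]

  CommonNeighbour : Fin n → Fin n → Set
  CommonNeighbour x y = ∃[ w ] (Adj G x w × Adj G w y)

  common-neighbour? : ∀ x y → Dec (CommonNeighbour x y)
  common-neighbour? x y = any? (λ w → adj? G x w ×-dec adj? G w y)

  common-neighbour-sym : ∀ {x y} → CommonNeighbour x y → CommonNeighbour y x
  common-neighbour-sym (w , xw , wy) = w , sym G wy , sym G xw

  common-neighbour⇒trail : ∀ {x y} → CommonNeighbour x y → Trail G x y 2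
  common-neighbour⇒trail (_ , xw , wy) = xw ∷ wy ∷ [ _ ]

  ∈nbhd⇒Adj : ∀ {v x} → x ∈ nbhd G v → Adj G v x
  ∈nbhd⇒Adj {v} {x} x∈nbhd
    with adj? G v x
       | trans (≡-sym (lookup∘tabulate (λ y → does (adj? G v y)) x)) ([]=⇒lookup x∈nbhd)
  ... | yes vx | _  = vx
  ... | no _   | ()

  meet⇒common-neighbour : ∀ {x y} → Nonempty (nbhd G x ∩ nbhd G y) → CommonNeighbour x y
  meet⇒common-neighbour {x} {y} (w , w∈) with x∈p∩q⁻ (nbhd G x) (nbhd G y) w∈
  ... | w∈N[x] , w∈N[y] = w , ∈nbhd⇒Adj w∈N[x] , sym G (∈nbhd⇒Adj w∈N[y])

  pairwise-common-neighbour : MinDegGtThird G → ∀ x y z →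
    CommonNeighbour x y ⊎ CommonNeighbour x z ⊎ CommonNeighbour y z
  pairwise-common-neighbour δ>n/3 x y z =
    map meet⇒common-neighbour (map meet⇒common-neighbour meet⇒common-neighbour)
      (pairwise-meet (nbhd G x) (nbhd G y) (nbhd G z)
        (<-sum-of-thirds (degree G x) (degree G y) (degree G z) (δ>n/3 x) (δ>n/3 y) (δ>n/3 z)))

lemma9p4 : (n : ℕ) (G : Graph n) → Connected G → MinDegGtThird G
         → (∀ v → InTriangle G v)
         → (u v : Fin n) → EvenTrailAtMost8 G u v
lemma9p4 n G connected δ>n/3 triangle u v
  with (a , _ , ua , _) ← triangle u
     | exit-edge (common-neighbour? G u) (proj₂ (connected u v)) (a , ua , sym G ua)
... | inj₁ u∼v = 1 , m≤m+n 2 6 , common-neighbour⇒trail G u∼v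
... | inj₂ (y , z , u∼y , yz , u≁z) with pairwise-common-neighbour G δ>n/3 u v z
...   | inj₁ u∼v        = 1 , m≤m+n 2 6 , common-neighbour⇒trail G u∼v
...   | inj₂ (inj₁ u∼z) = ⊥-elim (u≁z u∼z)
...   | inj₂ (inj₂ v∼z) = 4 , ≤-refl ,
          (triangle⇒closed-trail G (triangle u) ++ common-neighbour⇒trail G u∼y
            ++ (yz ∷ [ z ]) ++ common-neighbour⇒trail G (common-neighbour-sym G v∼z))
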